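{- Suppose that for every pair of consecutive primes $p_{k-1}<p_k$ such that $p_k$ is a Legendre prime, the inequality $\sqrt{p_k}-\sqrt{p_{k-1}}<1$ holds. Then for every integer $n\ge2$ there is a prime $p$ with $(n-1)^2<p<n^2$.
   Context: $p_1=2,p_2=3,\dots$ denotes the sequence of primes in increasing order. A prime $p$ is called a Legendre prime if there is an integer $a\ge1$ such that $p$ is the smallest prime greater than $a^2$; the Legendre primes are $2,5,11,17,29,37,53,\dots$. -}

module Defs where

open import Data.Nat using (ℕ; _+_; _*_; _∸_; _^_; _≤_; _<_)
open import Data.Nat.Primality using (Prime)
open import Data.Product using (Σ; ∃; _×_)
open import Data.Sum using (_⊎_)
open import Data.Empty using (⊥)

NextPrimeAfter : ℕ → ℕ → Set
NextPrimeAfter m p = Prime p × m < p × (∀ q → Prime q → m < q → p ≤ q)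

LegendrePrime : ℕ → Set
LegendrePrime p = ∃ λ a → 1 ≤ a × NextPrimeAfter (a ^ 2) p

ConsecutivePrimes : ℕ → ℕ → Set
ConsecutivePrimes q p =
  Prime q × Prime p × q < p × (∀ r → Prime r → q < r → r < p → ⊥)

-- SqrtDiffLt1 a b  encodes the real inequality  √a − √b < 1  for naturals a, b,
-- exactly: √a < √b + 1  ⇔  a < b + 1 + 2√b  ⇔  a ∸ (b+1) < 2√b (when a ≥ b+1),
-- and for a ≥ b+1 both sides are nonnegative, so this is (a − b − 1)² < 4b.
SqrtDiffLt1 : ℕ → ℕ → Set
SqrtDiffLt1 a b = a < b + 1 ⊎ (b + 1 ≤ a × (a ∸ (b + 1)) ^ 2 < 4 * b)

{-# OPTIONS --safe #-}
-- With a = n − 1 ≥ 2, let q be the greatest prime ≤ a² and p the least prime > a².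
-- They are consecutive and p is a Legendre prime.  If p ≥ (a + 1)², then
-- p − q − 1 ≥ (a + 1)² − a² − 1 = 2a ≥ 2√q, i.e. √p − √q ≥ 1, against the hypothesis.
module Submission where

open import Defs
open import Data.Nat using (ℕ; _∸_; _^_; _≤_; _<_)
open import Data.Nat.Primality using (Prime)
open import Data.Product using (∃; _×_)

open import Data.Nat.Base using (zero; suc; _+_; _*_; _!; z≤n; s≤s; NonZero)
open import Data.Nat.Properties
open import Data.Nat.Divisibility using (_∣_; divides; ∣-trans; m≤n⇒m!∣n!; m∣m*n; ∣m+n∣m⇒∣n; ∣1⇒≡1)
open import Data.Nat.Induction using (<-rec)
open import Data.Nat.ListAction using (product)
open import Data.Nat.Primality using (prime?; prime[2]; prime⇒nonZero; ¬prime[1])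
open import Data.Nat.Primality.Factorisation using (factorise)
open import Data.Nat.Solver using (module +-*-Solver)
open import Data.List.Base using ([]; _∷_)
open import Data.List.Relation.Unary.All using (_∷_)
open import Data.Product using (_,_)
open import Data.Sum using (inj₁; inj₂)
open import Data.Empty using (⊥)
open import Relation.Nullary using (¬_; yes; no; contradiction)
open import Relation.Nullary.Decidable using (_×-dec_)
open import Relation.Unary using (Pred; Decidable)
open import Relation.Binary.PropositionalEquality using (_≡_; refl; trans; cong; subst)
open +-*-Solver using (solve; _:+_; _:*_; _:^_; _:=_; con)

module _ {ℓ} {P : Pred ℕ ℓ} (P? : Decidable P) where

  least-satisfier : ∀ {n} → P n → ∃ λ k → P k × (∀ {j} → P j → k ≤ j)
  least-satisfier {n} = <-rec _ descend n
    where
    descend : ∀ n → (∀ {j} → j < n → P j → ∃ λ k → P k × (∀ {j} → P j → k ≤ j)) →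
             P n → ∃ λ k → P k × (∀ {j} → P j → k ≤ j)
    descend n rec Pn with anyUpTo? P? n
    ... | yes (j , j<n , Pj) = rec j<n Pj
    ... | no none = n , Pn , λ {j} Pj → ≮⇒≥ λ j<n → none (j , j<n , Pj)

  ≤-pred-unless : ∀ {n j} → ¬ P (suc n) → P j → j ≤ suc n → j ≤ n
  ≤-pred-unless ¬Psn Pj j≤sn = ≤-pred (≤∧≢⇒< j≤sn λ { refl → ¬Psn Pj })

  greatest-satisfier-≤ : ∀ m {k} → P k → k ≤ m → ∃ λ g → P g × g ≤ m × (∀ {j} → P j → j ≤ m → j ≤ g)
  greatest-satisfier-≤ m Pk k≤m with P? m
  ... | yes Pm = m , Pm , ≤-refl , λ _ j≤m → j≤m
  greatest-satisfier-≤ zero Pk z≤n | no ¬P0 = contradiction Pk ¬P0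
  greatest-satisfier-≤ (suc m) Pk k≤sm | no ¬Psm
    with g , Pg , g≤m , maximal ← greatest-satisfier-≤ m Pk (≤-pred-unless ¬Psm Pk k≤sm)
    = g , Pg , m≤n⇒m≤1+n g≤m , λ Pj j≤sm → maximal Pj (≤-pred-unless ¬Psm Pj j≤sm)

∃-prime-divisor : ∀ n → .{{NonZero n}} → 1 < n → ∃ λ p → Prime p × p ∣ n
∃-prime-divisor n 1<n with factorise n
... | record { factors = [] ; isFactorisation = n≡1 } = contradiction n≡1 (>⇒≢ 1<n)
... | record { factors = p ∷ ps ; isFactorisation = n≡p*ps ; factorsPrime = pp ∷ _ } =
  p , pp , divides (product ps) (trans n≡p*ps (*-comm p (product ps)))

n∣n! : ∀ n → .{{NonZero n}} → n ∣ n !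
n∣n! (suc n) = m∣m*n (n !)

∃-prime-> : ∀ m → ∃ λ p → Prime p × m < p
∃-prime-> m with ∃-prime-divisor (1 + m !) (s≤s (1≤n! m))
... | p , pp , p∣1+m! with m <? p
... | yes m<p = p , pp , m<p
... | no m≮p = contradiction (subst Prime (∣1⇒≡1 p∣1) pp) ¬prime[1]
  where
  instance _ = prime⇒nonZero pp
  p∣1 : p ∣ 1
  p∣1 = ∣m+n∣m⇒∣n (subst (p ∣_) (+-comm 1 (m !)) p∣1+m!) (∣-trans (n∣n! p) (m≤n⇒m!∣n! (≮⇒≥ m≮p)))

∃-nextPrimeAfter : ∀ m → ∃ (NextPrimeAfter m)
∃-nextPrimeAfter m with ∃-prime-> m
... | q , pq , m<q with least-satisfier (λ q → m <? q ×-dec prime? q) (m<q , pq)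
... | p , (m<p , pp) , minimal = p , pp , m<p , λ r pr m<r → minimal (m<r , pr)

GreatestPrimeUpTo : ℕ → ℕ → Set
GreatestPrimeUpTo m q = Prime q × q ≤ m × (∀ r → Prime r → r ≤ m → r ≤ q)

∃-greatestPrimeUpTo : ∀ m → 2 ≤ m → ∃ (GreatestPrimeUpTo m)
∃-greatestPrimeUpTo m 2≤m with q , pq , q≤m , maximal ← greatest-satisfier-≤ prime? m prime[2] 2≤m
  = q , pq , q≤m , λ r pr → maximal pr

greatestPrimeUpTo∧nextPrimeAfter⇒consecutive : ∀ {m q p} →
  GreatestPrimeUpTo m q → NextPrimeAfter m p → ConsecutivePrimes q p
greatestPrimeUpTo∧nextPrimeAfter⇒consecutive {m} {q} {p} (pq , q≤m , maximal) (pp , m<p , minimal) =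
  pq , pp , ≤-<-trans q≤m m<p , between
  where
  between : ∀ r → Prime r → q < r → r < p → ⊥
  between r pr q<r r<p with r ≤? m
  ... | yes r≤m = <⇒≱ q<r (maximal r pr r≤m)
  ... | no r≰m = <⇒≱ r<p (minimal r pr (≰⇒> r≰m))

¬sqrtDiffLt1 : ∀ {p q} → q < p → 4 * q ≤ (p ∸ (q + 1)) ^ 2 → ¬ SqrtDiffLt1 p q
¬sqrtDiffLt1 {p} {q} q<p _ (inj₁ p<q+1) = <⇒≱ p<q+1 (subst (_≤ p) (+-comm 1 q) q<p)
¬sqrtDiffLt1 _ 4q≤gap² (inj₂ (_ , gap²<4q)) = <⇒≱ gap²<4q 4q≤gap²

[1+a]²≡2a+[a²+1] : ∀ a → suc a ^ 2 ≡ 2 * a + (a ^ 2 + 1)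
[1+a]²≡2a+[a²+1] = solve 1 (λ a → (con 1 :+ a) :^ 2 := con 2 :* a :+ (a :^ 2 :+ con 1)) refl

[2a]²≡4a² : ∀ a → (2 * a) ^ 2 ≡ 4 * a ^ 2
[2a]²≡4a² = solve 1 (λ a → (con 2 :* a) :^ 2 := con 4 :* a :^ 2) refl

gap-across-square : ∀ a {q p} → q ≤ a ^ 2 → suc a ^ 2 ≤ p → 4 * q ≤ (p ∸ (q + 1)) ^ 2
gap-across-square a {q} {p} q≤a² [1+a]²≤p = begin
  4 * q             ≤⟨ *-monoʳ-≤ 4 q≤a² ⟩
  4 * a ^ 2         ≡⟨ [2a]²≡4a² a ⟨
  (2 * a) ^ 2       ≤⟨ ^-monoˡ-≤ 2 2a≤gap ⟩
  (p ∸ (q + 1)) ^ 2 ∎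
  where
  open ≤-Reasoning
  2a≤gap : 2 * a ≤ p ∸ (q + 1)
  2a≤gap = begin
    2 * a                             ≡⟨ m+n∸n≡m (2 * a) (a ^ 2 + 1) ⟨
    2 * a + (a ^ 2 + 1) ∸ (a ^ 2 + 1) ≡⟨ cong (_∸ (a ^ 2 + 1)) ([1+a]²≡2a+[a²+1] a) ⟨
    suc a ^ 2 ∸ (a ^ 2 + 1)           ≤⟨ ∸-mono [1+a]²≤p (+-monoˡ-≤ 1 q≤a²) ⟩
    p ∸ (q + 1)                       ∎

theorem19 : (∀ q p → ConsecutivePrimes q p → LegendrePrime p → SqrtDiffLt1 p q) →
    ∀ n → 2 ≤ n → ∃ λ p → Prime p × (n ∸ 1) ^ 2 < p × p < n ^ 2
theorem19 hyp (suc zero) (s≤s ())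
theorem19 hyp (suc (suc zero)) _ = 2 , prime[2] , s≤s (s≤s z≤n) , s≤s (s≤s (s≤s z≤n))
theorem19 hyp (suc a@(suc (suc _))) _
  with ∃-nextPrimeAfter (a ^ 2) | ∃-greatestPrimeUpTo (a ^ 2) 2≤a²
  where
  2≤a² : 2 ≤ a ^ 2
  2≤a² = ≤-trans (m≤m*n 2 2) (^-monoˡ-≤ 2 {2} {a} (s≤s (s≤s z≤n)))
... | p , next@(pp , a²<p , _) | q , greatest@(_ , q≤a² , _) with p <? suc a ^ 2
... | yes p<[1+a]² = p , pp , a²<p , p<[1+a]²
... | no p≮[1+a]² =
  contradiction (hyp q p consecutive (a , s≤s z≤n , next))
                (¬sqrtDiffLt1 (≤-<-trans q≤a² a²<p) (gap-across-square a q≤a² (≮⇒≥ p≮[1+a]²)))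
  where
  consecutive : ConsecutivePrimes q p
  consecutive = greatestPrimeUpTo∧nextPrimeAfter⇒consecutive greatest next
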